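{- Let $a,h,d,b$ be positive integers with $b\ge4$ and $\gcd(a,d)=1$, and let $A(a)=(a,ha+d,ha+2d,ha+bd,ha+(b+1)d)$. Suppose either $b$ is odd, $h\ge\left\lceil\frac{2d}{(b-3)(b+1)}\right\rceil$ and $a\ge\frac{(b-3)(b+1)^2}{2}$; or $b$ is even, $h\ge\left\lceil\frac{2d}{(b-2)(b+1)}\right\rceil$ and $a\ge\frac{(b-2)(b+1)^2}{2}$. Then $$g(A(a))=\begin{cases}\left\lfloor\frac{a}{b+1}\right\rfloor(ha+(b+1)d)+(j-1)d-a & \text{if } a\equiv j\in\{0,1\}\pmod{b+1},\\[2pt] \left\lfloor\frac{a}{b+1}\right\rfloor(ha+(b+1)d)+(j-1)d+(h-1)a & \text{if } a\equiv j\in\{2,3,\dots,b\}\pmod{b+1}.\end{cases}$$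
   Context: For positive integers $a_1,\dots,a_n$ with $\gcd=1$, the Frobenius number $g(a_1,\dots,a_n)$ is the largest integer not representable as $\sum x_ia_i$ with nonnegative integers $x_i$. -}

module Defs where

open import Data.Nat as ℕ using (ℕ; zero; suc; _+_; _*_)
open import Data.Nat.DivMod using (_/_)
open import Data.Integer as ℤ using (ℤ; +_; _<_)
open import Data.List using (List; length; zipWith)
open import Data.Nat.ListAction using (sum)
open import Data.Product using (Σ; _×_)
open import Relation.Binary.PropositionalEquality using (_≡_)
open import Relation.Nullary using (¬_)

Representable : List ℕ → ℤ → Set
Representable as z =
  Σ (List ℕ) λ xs → (length xs ≡ length as) × (+ sum (zipWith _*_ xs as) ≡ z)

IsFrobeniusNumber : List ℕ → ℤ → Set
IsFrobeniusNumber as g =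
  ¬ Representable as g × (∀ z → g < z → Representable as z)

-- ceiling division ⌈ m / n ⌉ (only used with n > 0; value 0 for n = 0)
⌈_/_⌉ : ℕ → ℕ → ℕ
⌈ m / zero ⌉ = 0
⌈ m / suc n ⌉ = (m + n) / suc n

A : ℕ → ℕ → ℕ → ℕ → List ℕ
A a h d b =
  a Data.List.∷ (h * a + d) Data.List.∷ (h * a + 2 * d) Data.List.∷
  (h * a + b * d) Data.List.∷ (h * a + (b + 1) * d) Data.List.∷ Data.List.[]

-- A combination of the generators is (x₀ + h n) a + s d with n = x₁ + x₂ + x₃ + x₄ parts and
-- s = x₁ + 2 x₂ + b x₃ + (b + 1) x₄ ≤ (b + 1) n. As gcd(a, d) = 1, every N > (a - 1) d is s d + w a
-- for some s < a, and N is representable as soon as h times the number of parts needed for s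
-- is at most w. Writing a = q (b + 1) + j, every s < a is a sum of at most K parts from
-- {1, b, b + 1}, where K = q if j ≤ 1 and K = q + 1 otherwise (this uses (b - 1)(b + 1) ≤ a),
-- whereas a - 1 is not a sum of fewer than K parts from {1, 2, b, b + 1}. Hence
-- g = (a - 1) d + (h K - 1) a, which is the claimed value.
module Submission where

open import Defs
open import Data.Nat using (ℕ; _+_; _*_; _∸_; _≤_; _^_; NonZero)
open import Data.Nat.DivMod using (_/_; _%_)
open import Data.Nat.GCD using (gcd)
open import Data.Integer using (ℤ; +_) renaming (_+_ to _+ℤ_; _-_ to _-ℤ_; _*_ to _*ℤ_)
open import Data.Product using (_×_)
open import Data.Sum using (_⊎_)
open import Relation.Binary.PropositionalEquality using (_≡_)

open import Algebra.Bundles using (AbelianGroup)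
open import Data.Empty using (⊥)
open import Data.Integer using (+<+) renaming (_<_ to _<ℤ_)
open import Data.List using ([]; _∷_; zipWith)
open import Data.Nat using (zero; suc; _<_; z≤n; s≤s; _≤?_; >-nonZero)
open import Data.Nat.Coprimality using (Coprime; coprime-Bézout; coprime-divisor; gcd≡1⇒coprime)
open import Data.Nat.Divisibility using (_∣_; ∣⇒≤; ∣m+n∣m⇒∣n; ∣m∣n⇒∣m+n; m∣m*n; n∣m*n)
open import Data.Nat.DivMod using (m≡m%n+[m/n]*n; m%n<n; m*n/n≡m; /-monoˡ-≤)
open import Data.Nat.GCD using (module Bézout)
open import Data.Nat.ListAction using (sum)
open import Data.Nat.Properties
open import Data.Nat.Tactic.RingSolver using (solve-∀)
open import Data.Product using (∃-syntax; _,_; map₂)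
open import Data.Sum using (inj₁; inj₂; [_,_])
open import Relation.Nullary using (¬_; yes; no)
open import Relation.Binary.PropositionalEquality using (refl; sym; trans; cong; cong₂; subst; module ≡-Reasoning)
import Data.Integer.Properties as ℤ
import Data.Integer.Tactic.RingSolver as ℤ-Solver
open import Algebra.Properties.Group (AbelianGroup.group ℤ.+-0-abelianGroup) using (∙-cancelʳ)

-- x₁, x₃, x₄ count the parts 1, b, b + 1, i.e. the d-coefficients of the generators
-- h a + d, h a + b d and h a + (b + 1) d.
SumOfParts : ℕ → ℕ → ℕ → Set
SumOfParts b k s = ∃[ x₁ ] ∃[ x₃ ] ∃[ x₄ ] x₁ + x₃ * b + x₄ * suc b ≡ s × x₁ + x₃ + x₄ ≤ k

SumOfParts-mono : ∀ {b k k′ s} → k ≤ k′ → SumOfParts b k s → SumOfParts b k′ s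
SumOfParts-mono k≤k′ (x₁ , x₃ , x₄ , sum≡s , parts≤k) = x₁ , x₃ , x₄ , sum≡s , ≤-trans parts≤k k≤k′

multiple-SumOfParts : ∀ b m → SumOfParts b m (m * suc b)
multiple-SumOfParts b m = 0 , 0 , m , refl , ≤-refl

-- r ones and m parts b + 1, or, when m ≥ b - r, (b + 1 - r) parts b and m - (b - r) parts b + 1.
residue-SumOfParts : ∀ {b} r m → 0 < r → r ≤ b →
  SumOfParts b (b ∸ 1) (r + m * suc b) ⊎ SumOfParts b (suc m) (r + m * suc b)
residue-SumOfParts (suc r) m _ r≤b with m≤n⇒∃[o]m+o≡n r≤b
... | t , refl with t ≤? m
...   | no t≰m = inj₁ (suc r , 0 , m , cong (λ x → suc x + m * suc (suc r + t)) (+-identityʳ r) ,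
                     subst (λ x → suc x + m ≤ r + t) (sym (+-identityʳ r)) (+-monoʳ-< r (≰⇒> t≰m)))
...   | yes t≤m with m≤n⇒∃[o]m+o≡n t≤m
...     | e , refl = inj₂ (0 , suc t , e , regroup t r e , ≤-refl)
  where
  regroup : ∀ t r e → suc t * (suc r + t) + e * suc (suc r + t) ≡ suc r + (t + e) * suc (suc r + t)
  regroup = solve-∀

SumOfParts-below : ∀ {b a k} →
  (∀ {m} → m * suc b < a → m ≤ k) →
  (∀ {r m} → 0 < r → r + m * suc b < a → suc m ≤ k) →
  b ∸ 1 ≤ k → ∀ {s} → s < a → SumOfParts b k s
SumOfParts-below {b} {a} {k} bound₀ bound₁ b∸1≤k {s} s<a
  with s % suc b | m%n<n s (suc b) | m≡m%n+[m/n]*n s (suc b)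
... | zero  | _     | s≡ = subst (SumOfParts b k) (sym s≡)
      (SumOfParts-mono (bound₀ (subst (_< a) s≡ s<a)) (multiple-SumOfParts b (s / suc b)))
... | suc r | r<1+b | s≡ = subst (SumOfParts b k) (sym s≡)
      ([ SumOfParts-mono b∸1≤k , SumOfParts-mono (bound₁ (s≤s z≤n) (subst (_< a) s≡ s<a)) ]
        (residue-SumOfParts (suc r) (s / suc b) (s≤s z≤n) (≤-pred r<1+b)))

quotient-≤ : ∀ {B r m j q} → j ≤ B → r + m * B < j + q * B → m ≤ q
quotient-≤ {B} {r} {m} {j} {q} j≤B lt = ≤-pred (*-cancelʳ-< B m (suc q) (begin-strict
  m * B         ≤⟨ m≤n+m (m * B) r ⟩
  r + m * B     <⟨ lt ⟩
  j + q * B     ≤⟨ +-monoˡ-≤ (q * B) j≤B ⟩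
  suc q * B     ∎))
  where open ≤-Reasoning

quotient-< : ∀ {B r m j q} → j ≤ r → r + m * B < j + q * B → m < q
quotient-< {B} {r} {m} {j} {q} j≤r lt =
  *-cancelʳ-< B m q (+-cancelˡ-< r (m * B) (q * B) (<-≤-trans lt (+-monoˡ-≤ (q * B) j≤r)))

A-combination : ∀ {a h d b} x₀ x₁ x₂ x₃ x₄ →
  sum (zipWith _*_ (x₀ ∷ x₁ ∷ x₂ ∷ x₃ ∷ x₄ ∷ []) (A a h d b))
    ≡ (x₀ + h * (x₁ + x₂ + x₃ + x₄)) * a + (x₁ + 2 * x₂ + x₃ * b + x₄ * suc b) * d
A-combination {a} {h} {d} {b} = expand a h d b
  where
  expand : ∀ a h d b x₀ x₁ x₂ x₃ x₄ →
    x₀ * a + (x₁ * (h * a + d) + (x₂ * (h * a + 2 * d) + (x₃ * (h * a + b * d) + (x₄ * (h * a + (b + 1) * d) + 0))))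
      ≡ (x₀ + h * (x₁ + x₂ + x₃ + x₄)) * a + (x₁ + 2 * x₂ + x₃ * b + x₄ * suc b) * d
  expand = solve-∀

parts-bound : ∀ {b} → 1 ≤ b → ∀ x₁ x₂ x₃ x₄ →
  x₁ + 2 * x₂ + x₃ * b + x₄ * suc b ≤ (x₁ + x₂ + x₃ + x₄) * suc b
parts-bound {suc c} _ x₁ x₂ x₃ x₄ =
  ≤-trans (m≤m+n _ (x₁ * suc c + x₂ * c + x₃)) (≤-reflexive (sym (split c x₁ x₂ x₃ x₄)))
  where
  split : ∀ c x₁ x₂ x₃ x₄ → (x₁ + x₂ + x₃ + x₄) * suc (suc c)
    ≡ (x₁ + 2 * x₂ + x₃ * suc c + x₄ * suc (suc c)) + (x₁ * suc c + x₂ * c + x₃)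
  split = solve-∀

inverse-mod : ∀ {a d} → 2 ≤ a → Coprime a d → ∃[ u ] ∃[ v ] u * d ≡ 1 + v * a
inverse-mod {a} {d} 2≤a cop with coprime-Bézout cop
... | Bézout.-+ x y 1+xa≡yd = y , x , sym 1+xa≡yd
... | Bézout.+- zero y ()
-- here y d ≡ -1 (mod a), so (a - 1) y is an inverse of d
... | Bézout.+- (suc x) y 1+yd≡[1+x]a with 2≤a
...   | s≤s (s≤s {n = a″} z≤n) = suc a″ * y , a″ + x + a″ * x , +-cancelʳ-≡ (suc a″) _ _ (begin
  suc a″ * y * d + suc a″              ≡⟨ factor a″ y d ⟩
  suc a″ * (1 + y * d)                 ≡⟨ cong (suc a″ *_) 1+yd≡[1+x]a ⟩
  suc a″ * (suc x * suc (suc a″))      ≡⟨ unfactor a″ x ⟩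
  1 + (a″ + x + a″ * x) * suc (suc a″) + suc a″ ∎)
  where
  open ≡-Reasoning
  factor : ∀ a″ y d → suc a″ * y * d + suc a″ ≡ suc a″ * (1 + y * d)
  factor = solve-∀
  unfactor : ∀ a″ x → suc a″ * (suc x * suc (suc a″)) ≡ 1 + (a″ + x + a″ * x) * suc (suc a″) + suc a″
  unfactor = solve-∀

≤-congruent⇒∃-multiple : ∀ {x y a p q} → x ≤ y → x + p * a ≡ y + q * a → ∃[ w ] x + w * a ≡ y
≤-congruent⇒∃-multiple {x} {y} {a} {p} {q} x≤y eq with q ≤? p
... | no q≰p = 0 , trans (+-identityʳ x) (≤-antisym x≤y y≤x)
  where
  open ≤-Reasoning
  y≤x : y ≤ x
  y≤x = +-cancelʳ-≤ (q * a) y x (begin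
    y + q * a ≡⟨ sym eq ⟩
    x + p * a ≤⟨ +-monoʳ-≤ x (*-monoˡ-≤ a (<⇒≤ (≰⇒> q≰p))) ⟩
    x + q * a ∎)
... | yes q≤p with m≤n⇒∃[o]m+o≡n q≤p
...   | w , refl = w , +-cancelʳ-≡ (q * a) _ _ (trans (shift x w q a) eq)
  where
  shift : ∀ x w q a → x + w * a + q * a ≡ x + (q + w) * a
  shift = solve-∀

residue-representation : ∀ {a d N} → 2 ≤ a → Coprime a d → (a ∸ 1) * d ≤ N →
  ∃[ s ] ∃[ w ] s < a × s * d + w * a ≡ N
residue-representation {suc a′} {d} {N} 2≤a cop bound with inverse-mod 2≤a cop
... | u , v , ud≡1+va = s , map₂ (s<a ,_) apart
  where
  open ≡-Reasoning
  s = N * u % suc a′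
  c = N * u / suc a′
  s<a : s < suc a′
  s<a = m%n<n (N * u) (suc a′)
  regroup : ∀ s c d a → s * d + c * d * a ≡ (s + c * a) * d
  regroup = solve-∀
  distribute : ∀ N v a → N * (1 + v * a) ≡ N + N * v * a
  distribute = solve-∀
  congruent : s * d + c * d * suc a′ ≡ N + N * v * suc a′
  congruent = begin
    s * d + c * d * suc a′    ≡⟨ regroup s c d (suc a′) ⟩
    (s + c * suc a′) * d      ≡⟨ cong (_* d) (sym (m≡m%n+[m/n]*n (N * u) (suc a′))) ⟩
    N * u * d                 ≡⟨ *-assoc N u d ⟩
    N * (u * d)               ≡⟨ cong (N *_) ud≡1+va ⟩
    N * (1 + v * suc a′)      ≡⟨ distribute N v (suc a′) ⟩
    N + N * v * suc a′        ∎
  apart : ∃[ w ] s * d + w * suc a′ ≡ N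
  apart = ≤-congruent⇒∃-multiple {p = c * d} {q = N * v} (≤-trans (*-monoˡ-≤ d (≤-pred s<a)) bound) congruent

module Criterion {a h d b K : ℕ} (1≤b : 1 ≤ b) (cop : Coprime a d) (1≤hK : 1 ≤ h * K)
  (cover : ∀ {s} → s < a → SumOfParts b K s) (room : ∀ {m} → m < K → m * suc b + 2 ≤ a) where

  2≤a : 2 ≤ a
  2≤a = room (*-cancelˡ-< h 0 K (subst (_< h * K) (sym (*-zeroʳ h)) 1≤hK))

  0<a : 0 < a
  0<a = ≤-trans (s≤s z≤n) 2≤a

  instance
    a-nonZero : NonZero a
    a-nonZero = >-nonZero 0<a

  a≤hKa : a ≤ h * K * a
  a≤hKa = subst (_≤ h * K * a) (*-identityˡ a) (*-monoˡ-≤ a 1≤hK)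

  d+a≤ad+hKa : d + a ≤ a * d + h * K * a
  d+a≤ad+hKa = +-mono-≤ (subst (_≤ a * d) (*-identityˡ d) (*-monoˡ-≤ d 0<a)) a≤hKa

  F : ℕ
  F = a * d + h * K * a ∸ (d + a)

  F-eq : F + (d + a) ≡ a * d + h * K * a
  F-eq = m∸n+n≡m d+a≤ad+hKa

  [a∸1]d≤F : (a ∸ 1) * d ≤ F
  [a∸1]d≤F = +-cancelʳ-≤ d _ _ (+-cancelʳ-≤ a _ _ (begin
    (a ∸ 1) * d + d + a ≡⟨ cong (_+ a) [a∸1]d+d≡ad ⟩
    a * d + a           ≤⟨ +-monoʳ-≤ (a * d) a≤hKa ⟩
    a * d + h * K * a   ≡⟨ sym F-eq ⟩
    F + (d + a)         ≡⟨ sym (+-assoc F d a) ⟩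
    F + d + a           ∎))
    where
    open ≤-Reasoning
    [a∸1]d+d≡ad : (a ∸ 1) * d + d ≡ a * d
    [a∸1]d+d≡ad = trans (cong (λ x → (a ∸ 1) * d + x) (sym (*-identityˡ d)))
      (trans (sym (*-distribʳ-+ d (a ∸ 1) 1)) (cong (_* d) (m∸n+n≡m 0<a)))

  -- Modulo a the equation gives a ∣ (s + 1) d, so s ≥ a - 1; comparing the a-parts then gives
  -- n < K, and room contradicts s ≤ n (b + 1).
  F≢combination : ∀ X n s → h * n ≤ X → s ≤ n * suc b → X * a + s * d ≡ F → ⊥
  F≢combination X n s hn≤X s≤nB Xa+sd≡F = <-irrefl refl (begin-strict
    suc s           <⟨ n<1+n (suc s) ⟩
    suc (suc s)     ≡⟨ +-comm 2 s ⟩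
    s + 2           ≤⟨ +-monoˡ-≤ 2 s≤nB ⟩
    n * suc b + 2   ≤⟨ room n<K ⟩
    a               ≤⟨ a≤1+s ⟩
    suc s           ∎)
    where
    open ≤-Reasoning
    shift : ∀ X a s d → suc X * a + suc s * d ≡ X * a + s * d + (d + a)
    shift = solve-∀
    E : suc X * a + suc s * d ≡ a * d + h * K * a
    E = trans (shift X a s d) (trans (cong (_+ (d + a)) Xa+sd≡F) F-eq)
    a∣[1+s]d : a ∣ suc s * d
    a∣[1+s]d = ∣m+n∣m⇒∣n (subst (a ∣_) (sym E) (∣m∣n⇒∣m+n (m∣m*n d) (n∣m*n (h * K)))) (n∣m*n (suc X))
    a≤1+s : a ≤ suc s
    a≤1+s = ∣⇒≤ (coprime-divisor cop (subst (a ∣_) (*-comm (suc s) d) a∣[1+s]d))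
    1+X≤hK : suc X ≤ h * K
    1+X≤hK = *-cancelʳ-≤ (suc X) (h * K) a (+-cancelˡ-≤ (a * d) _ _ (begin
      a * d + suc X * a         ≤⟨ +-monoˡ-≤ (suc X * a) (*-monoˡ-≤ d a≤1+s) ⟩
      suc s * d + suc X * a     ≡⟨ +-comm (suc s * d) (suc X * a) ⟩
      suc X * a + suc s * d     ≡⟨ E ⟩
      a * d + h * K * a         ∎))
    n<K : n < K
    n<K = *-cancelˡ-< h n K (≤-trans (s≤s hn≤X) 1+X≤hK)

  F-not-representable : ¬ Representable (A a h d b) (+ F)
  F-not-representable (x₀ ∷ x₁ ∷ x₂ ∷ x₃ ∷ x₄ ∷ [] , _ , combination≡F) =
    F≢combination (x₀ + h * (x₁ + x₂ + x₃ + x₄)) (x₁ + x₂ + x₃ + x₄) (x₁ + 2 * x₂ + x₃ * b + x₄ * suc b)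
      (m≤n+m _ x₀) (parts-bound 1≤b x₁ x₂ x₃ x₄)
      (trans (sym (A-combination {a} {h} {d} {b} x₀ x₁ x₂ x₃ x₄)) (ℤ.+-injective combination≡F))
  F-not-representable ([] , () , _)
  F-not-representable (_ ∷ [] , () , _)
  F-not-representable (_ ∷ _ ∷ [] , () , _)
  F-not-representable (_ ∷ _ ∷ _ ∷ [] , () , _)
  F-not-representable (_ ∷ _ ∷ _ ∷ _ ∷ [] , () , _)
  F-not-representable (_ ∷ _ ∷ _ ∷ _ ∷ _ ∷ _ ∷ _ , () , _)

  h*n≤w : ∀ {N s w n} → F < N → s < a → n ≤ K → s * d + w * a ≡ N → h * n ≤ w
  h*n≤w {N} {s} {w} {n} F<N s<a n≤K sd+wa≡N =
    ≤-pred (*-cancelʳ-< a (h * n) (suc w) (+-cancelˡ-< (suc s * d) (h * n * a) (suc w * a) (begin-strict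
      suc s * d + h * n * a     ≤⟨ +-mono-≤ (*-monoˡ-≤ d s<a) (*-monoˡ-≤ a (*-monoʳ-≤ h n≤K)) ⟩
      a * d + h * K * a         ≡⟨ sym F-eq ⟩
      F + (d + a)               <⟨ +-monoˡ-< (d + a) F<N ⟩
      N + (d + a)               ≡⟨ cong (_+ (d + a)) (sym sd+wa≡N) ⟩
      s * d + w * a + (d + a)   ≡⟨ shift s d w a ⟩
      suc s * d + suc w * a     ∎)))
    where
    open ≤-Reasoning
    shift : ∀ s d w a → s * d + w * a + (d + a) ≡ suc s * d + suc w * a
    shift = solve-∀

  above-F-representable : ∀ {N} → F < N → Representable (A a h d b) (+ N)
  above-F-representable {N} F<N with residue-representation 2≤a cop (≤-trans [a∸1]d≤F (<⇒≤ F<N))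
  ... | s , w , s<a , sd+wa≡N with cover s<a
  ...   | x₁ , x₃ , x₄ , parts≡s , n≤K with m≤n⇒∃[o]m+o≡n (h*n≤w {w = w} F<N s<a n≤K sd+wa≡N)
  ...     | x₀ , hn+x₀≡w = x₀ ∷ x₁ ∷ 0 ∷ x₃ ∷ x₄ ∷ [] , refl , cong +_ (begin
    sum (zipWith _*_ (x₀ ∷ x₁ ∷ 0 ∷ x₃ ∷ x₄ ∷ []) (A a h d b))
      ≡⟨ A-combination {a} {h} {d} {b} x₀ x₁ 0 x₃ x₄ ⟩
    (x₀ + h * (x₁ + 0 + x₃ + x₄)) * a + (x₁ + 2 * 0 + x₃ * b + x₄ * suc b) * d
      ≡⟨ drop-x₂ x₀ x₁ x₃ x₄ h a b d ⟩
    (h * (x₁ + x₃ + x₄) + x₀) * a + (x₁ + x₃ * b + x₄ * suc b) * d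
      ≡⟨ cong₂ (λ p q → p * a + q * d) hn+x₀≡w parts≡s ⟩
    w * a + s * d
      ≡⟨ trans (+-comm (w * a) (s * d)) sd+wa≡N ⟩
    N ∎)
    where
    open ≡-Reasoning
    drop-x₂ : ∀ x₀ x₁ x₃ x₄ h a b d →
      (x₀ + h * (x₁ + 0 + x₃ + x₄)) * a + (x₁ + 2 * 0 + x₃ * b + x₄ * suc b) * d
        ≡ (h * (x₁ + x₃ + x₄) + x₀) * a + (x₁ + x₃ * b + x₄ * suc b) * d
    drop-x₂ = solve-∀

  frobenius-criterion : ∀ {E} → E +ℤ + (d + a) ≡ + (a * d + h * K * a) → IsFrobeniusNumber (A a h d b) E
  frobenius-criterion {E} E-eq = subst (IsFrobeniusNumber (A a h d b)) (sym E≡F) (F-not-representable , above)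
    where
    E≡F : E ≡ + F
    E≡F = ∙-cancelʳ (+ (d + a)) E (+ F) (trans E-eq (trans (cong +_ (sym F-eq)) (ℤ.pos-+ F (d + a))))
    above : ∀ z → + F <ℤ z → Representable (A a h d b) z
    above (+ N) (+<+ F<N) = above-F-representable F<N

open Criterion using (frobenius-criterion)

[b∸1][1+b]≤a : ∀ {a h d b} → 4 ≤ b →
  ((b % 2 ≡ 1 × ⌈ (2 * d) / ((b ∸ 3) * (b + 1)) ⌉ ≤ h × (b ∸ 3) * (b + 1) ^ 2 ≤ 2 * a)
    ⊎ (b % 2 ≡ 0 × ⌈ (2 * d) / ((b ∸ 2) * (b + 1)) ⌉ ≤ h × (b ∸ 2) * (b + 1) ^ 2 ≤ 2 * a)) →
  (b ∸ 1) * suc b ≤ a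
[b∸1][1+b]≤a (s≤s (s≤s (s≤s (s≤s (z≤n {zero}))))) (inj₁ (() , _))
[b∸1][1+b]≤a (s≤s (s≤s (s≤s (s≤s (z≤n {suc e}))))) (inj₁ (_ , _ , bound)) =
  *-cancelˡ-≤ 2 (≤-trans (m≤m+n _ _) (≤-trans (≤-reflexive (sym (odd-split e))) bound))
  where
  odd-split : ∀ e → (2 + e) * ((5 + e + 1) * ((5 + e + 1) * 1)) ≡ 2 * ((4 + e) * (6 + e)) + (6 + e) * (4 + 6 * e + e * e)
  odd-split = solve-∀
[b∸1][1+b]≤a (s≤s (s≤s (s≤s (s≤s (z≤n {e}))))) (inj₂ (_ , _ , bound)) =
  *-cancelˡ-≤ 2 (≤-trans (m≤m+n _ _) (≤-trans (≤-reflexive (sym (even-split e))) bound))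
  where
  even-split : ∀ e → (2 + e) * ((4 + e + 1) * ((4 + e + 1) * 1)) ≡ 2 * ((3 + e) * (5 + e)) + (5 + e) * (4 + 5 * e + e * e)
  even-split = solve-∀

frobenius-low : ∀ {a h d b j q} → a ≡ j + q * suc b → j ≤ 1 → 1 ≤ h → 2 ≤ b → b ∸ 1 ≤ q → Coprime a d →
  IsFrobeniusNumber (A a h d b) ((+ q *ℤ + (h * a + (b + 1) * d)) +ℤ ((+ j -ℤ + 1) *ℤ + d) -ℤ + a)
frobenius-low {h = h} {d} {b} {j} {q} refl j≤1 1≤h 2≤b b∸1≤q cop =
  frobenius-criterion {h = h} (<⇒≤ 2≤b) cop (*-mono-≤ 1≤h 1≤q)
    (SumOfParts-below (quotient-≤ (≤-trans j≤1 (s≤s z≤n))) (λ 0<r → quotient-< (≤-trans j≤1 0<r)) b∸1≤q)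
    room value
  where
  a = j + q * suc b
  X = h * a + (b + 1) * d
  1≤q : 1 ≤ q
  1≤q = ≤-trans (∸-monoˡ-≤ 1 2≤b) b∸1≤q
  room : ∀ {m} → m < q → m * suc b + 2 ≤ a
  room {m} m<q = begin
    m * suc b + 2       ≤⟨ +-monoʳ-≤ (m * suc b) (s≤s (<⇒≤ 2≤b)) ⟩
    m * suc b + suc b   ≡⟨ +-comm (m * suc b) (suc b) ⟩
    suc m * suc b       ≤⟨ *-monoˡ-≤ (suc b) m<q ⟩
    q * suc b           ≤⟨ m≤n+m (q * suc b) j ⟩
    a                   ∎
    where open ≤-Reasoning
  shift : ∀ P J D A → P +ℤ (J -ℤ + 1) *ℤ D -ℤ A +ℤ (D +ℤ A) ≡ P +ℤ J *ℤ D
  shift = ℤ-Solver.solve-∀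
  expand : ∀ h d b j q → q * (h * (j + q * suc b) + (b + 1) * d) + j * d
    ≡ (j + q * suc b) * d + h * q * (j + q * suc b)
  expand = solve-∀
  E : ℤ
  E = (+ q *ℤ + X) +ℤ ((+ j -ℤ + 1) *ℤ + d) -ℤ + a
  value : E +ℤ + (d + a) ≡ + (a * d + h * q * a)
  value = begin
    E +ℤ + (d + a)
      ≡⟨ cong (E +ℤ_) (ℤ.pos-+ d a) ⟩
    E +ℤ (+ d +ℤ + a)
      ≡⟨ shift (+ q *ℤ + X) (+ j) (+ d) (+ a) ⟩
    + q *ℤ + X +ℤ + j *ℤ + d
      ≡⟨ sym (trans (ℤ.pos-+ (q * X) (j * d)) (cong₂ _+ℤ_ (ℤ.pos-* q X) (ℤ.pos-* j d))) ⟩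
    + (q * X + j * d)
      ≡⟨ cong +_ (expand h d b j q) ⟩
    + (a * d + h * q * a) ∎
    where open ≡-Reasoning

frobenius-high : ∀ {a h d b j q} → a ≡ j + q * suc b → j ≤ b → 2 ≤ j → 1 ≤ h → 1 ≤ b → b ∸ 1 ≤ q → Coprime a d →
  IsFrobeniusNumber (A a h d b) ((+ q *ℤ + (h * a + (b + 1) * d)) +ℤ ((+ j -ℤ + 1) *ℤ + d) +ℤ (+ h -ℤ + 1) *ℤ + a)
frobenius-high {h = h} {d} {b} {j} {q} refl j≤b 2≤j 1≤h 1≤b b∸1≤q cop =
  frobenius-criterion {h = h} 1≤b cop (*-mono-≤ 1≤h (s≤s z≤n))
    (SumOfParts-below (λ lt → m≤n⇒m≤1+n (quotient-≤ j≤1+b lt)) (λ _ lt → s≤s (quotient-≤ j≤1+b lt))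
      (m≤n⇒m≤1+n b∸1≤q))
    room value
  where
  a = j + q * suc b
  X = h * a + (b + 1) * d
  j≤1+b : j ≤ suc b
  j≤1+b = m≤n⇒m≤1+n j≤b
  room : ∀ {m} → m < suc q → m * suc b + 2 ≤ a
  room {m} m<1+q = begin
    m * suc b + 2   ≤⟨ +-mono-≤ (*-monoˡ-≤ (suc b) (≤-pred m<1+q)) 2≤j ⟩
    q * suc b + j   ≡⟨ +-comm (q * suc b) j ⟩
    a               ∎
    where open ≤-Reasoning
  shift : ∀ P J D H A → P +ℤ (J -ℤ + 1) *ℤ D +ℤ (H -ℤ + 1) *ℤ A +ℤ (D +ℤ A) ≡ P +ℤ J *ℤ D +ℤ H *ℤ A
  shift = ℤ-Solver.solve-∀
  expand : ∀ h d b j q → q * (h * (j + q * suc b) + (b + 1) * d) + j * d + h * (j + q * suc b)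
    ≡ (j + q * suc b) * d + h * suc q * (j + q * suc b)
  expand = solve-∀
  E : ℤ
  E = (+ q *ℤ + X) +ℤ ((+ j -ℤ + 1) *ℤ + d) +ℤ (+ h -ℤ + 1) *ℤ + a
  value : E +ℤ + (d + a) ≡ + (a * d + h * suc q * a)
  value = begin
    E +ℤ + (d + a)
      ≡⟨ cong (E +ℤ_) (ℤ.pos-+ d a) ⟩
    E +ℤ (+ d +ℤ + a)
      ≡⟨ shift (+ q *ℤ + X) (+ j) (+ d) (+ h) (+ a) ⟩
    + q *ℤ + X +ℤ + j *ℤ + d +ℤ + h *ℤ + a
      ≡⟨ sym (trans (ℤ.pos-+ (q * X + j * d) (h * a)) (cong₂ _+ℤ_
           (trans (ℤ.pos-+ (q * X) (j * d)) (cong₂ _+ℤ_ (ℤ.pos-* q X) (ℤ.pos-* j d))) (ℤ.pos-* h a))) ⟩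
    + (q * X + j * d + h * a)
      ≡⟨ cong +_ (expand h d b j q) ⟩
    + (a * d + h * suc q * a) ∎
    where open ≡-Reasoning

theorem3p7 : (a h d b : ℕ) → 1 ≤ a → 1 ≤ h → 1 ≤ d → 4 ≤ b → gcd a d ≡ 1 →
    ((b % 2 ≡ 1 × ⌈ (2 * d) / ((b ∸ 3) * (b + 1)) ⌉ ≤ h × (b ∸ 3) * (b + 1) ^ 2 ≤ 2 * a)
      ⊎ (b % 2 ≡ 0 × ⌈ (2 * d) / ((b ∸ 2) * (b + 1)) ⌉ ≤ h × (b ∸ 2) * (b + 1) ^ 2 ≤ 2 * a)) →
    (((a % (1 + b) ≤ 1) → IsFrobeniusNumber (A a h d b)
        ((+ (a / (1 + b)) *ℤ + (h * a + (b + 1) * d)) +ℤ ((+ (a % (1 + b)) -ℤ + 1) *ℤ + d) -ℤ + a))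
      × ((2 ≤ a % (1 + b)) → IsFrobeniusNumber (A a h d b)
        ((+ (a / (1 + b)) *ℤ + (h * a + (b + 1) * d)) +ℤ ((+ (a % (1 + b)) -ℤ + 1) *ℤ + d) +ℤ (+ h -ℤ + 1) *ℤ + a)))
theorem3p7 a h d b _ 1≤h _ 4≤b gcd≡1 hyp =
    (λ j≤1 → frobenius-low a≡j+qB j≤1 1≤h (≤-trans (s≤s (s≤s z≤n)) 4≤b) b∸1≤q cop)
  , (λ 2≤j → frobenius-high a≡j+qB (≤-pred (m%n<n a (suc b))) 2≤j 1≤h (≤-trans (s≤s z≤n) 4≤b) b∸1≤q cop)
  where
  cop : Coprime a d
  cop = gcd≡1⇒coprime gcd≡1
  a≡j+qB : a ≡ a % suc b + a / suc b * suc b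
  a≡j+qB = m≡m%n+[m/n]*n a (suc b)
  b∸1≤q : b ∸ 1 ≤ a / suc b
  b∸1≤q = subst (_≤ a / suc b) (m*n/n≡m (b ∸ 1) (suc b)) (/-monoˡ-≤ (suc b) ([b∸1][1+b]≤a {a} {h} {d} 4≤b hyp))
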